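{- There are no odd primes $a,b,c$ such that $a^2+a+1$ and $b^2+b+1$ are prime and $c^2+c+1=3(a^2+a+1)(b^2+b+1)$. -}

module Defs where

open import Data.Nat using (ℕ; _+_; _*_)

f : ℕ → ℕ
f x = x * x + x + 1

module Submission where

-- Idea of the proof.  Write p = f a and q = f b, and suppose by symmetry
-- that b ≤ a, so that f c = 3pq ≤ 3p².  An odd prime a is at least 3.
--
-- Since f c > p we have c > a, and
--   f c - f a = (c - a)(c + a + 1), so the prime p divides one of the two
--   factors.  Neither factor equals p, since otherwise c = (a + 1)² or
--   c = a², contradicting the primality of c; hence the factor is at
--   least 2p, which gives c + a + 1 ≥ 2p, i.e. c ≥ 2a² + a + 1.
-- * Upper bound.  f (2a² + a + 1) = 3p² + a(a - 3)p ≥ 3p² ≥ f c, so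
--   c ≤ 2a² + a + 1 because f is strictly increasing.
--
-- Hence c = 2a² + a + 1, which is even because a is odd: contradiction.

open import Defs
open import Data.Nat using (ℕ; zero; suc; _+_; _*_; _≤_; _<_; z≤n; s≤s; z<s; >-nonZero)
open import Data.Nat.Properties
open import Data.Nat.Primality using (Prime; euclidsLemma; prime⇒irreducible; ¬prime[0]; ¬prime[1])
open import Data.Nat.Divisibility using (_∣_; divides; ∣-refl; ∣m+n∣m⇒∣n; ∣m∣n⇒∣m+n; m∣m*n; ∣n⇒∣m*n)
open import Data.Nat.Tactic.RingSolver using (solve-∀)
open import Data.Product using (∃-syntax; _×_; _,_)
open import Data.Sum using (_⊎_; inj₁; inj₂)
open import Data.Empty using (⊥; ⊥-elim)
open import Relation.Nullary using (¬_)
open import Relation.Binary.PropositionalEquality using (_≡_; _≢_; refl; sym; trans; cong; subst)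

f-positive : ∀ x → 0 < f x
f-positive x = subst (0 <_) (+-comm 1 (x * x + x)) z<s

f-mono-≤ : ∀ {x y} → x ≤ y → f x ≤ f y
f-mono-≤ x≤y = +-monoˡ-≤ 1 (+-mono-≤ (*-mono-≤ x≤y x≤y) x≤y)

f-mono-< : ∀ {x y} → x < y → f x < f y
f-mono-< x<y = +-monoˡ-< 1 (+-mono-< (*-mono-< x<y x<y) x<y)

f-reflects-< : ∀ {x y} → f x < f y → x < y
f-reflects-< fx<fy = ≰⇒> (λ y≤x → <⇒≱ fx<fy (f-mono-≤ y≤x))

f-reflects-≤ : ∀ {x y} → f x ≤ f y → x ≤ y
f-reflects-≤ fx≤fy = ≮⇒≥ (λ y<x → <⇒≱ (f-mono-< y<x) fx≤fy)

-- f c - f a = (c - a)(c + a + 1), written additively with c = a + k.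
f-difference : ∀ a k → f (a + k) ≡ f a + k * (a + k + suc a)
f-difference = expanded
  where
  expanded : ∀ a k → (a + k) * (a + k) + (a + k) + 1 ≡ (a * a + a + 1) + k * (a + k + suc a)
  expanded = solve-∀

-- The two ways a difference c - a or a sum c + a + 1 can equal f a.
a+f[a]≡square : ∀ a → a + f a ≡ suc a * suc a
a+f[a]≡square = expanded
  where
  expanded : ∀ a → a + (a * a + a + 1) ≡ suc a * suc a
  expanded = solve-∀

f[a]≡square+suc : ∀ a → f a ≡ a * a + suc a
f[a]≡square+suc = expanded
  where
  expanded : ∀ a → a * a + a + 1 ≡ a * a + suc a
  expanded = solve-∀

square-not-prime : ∀ n → 2 ≤ n → ¬ Prime (n * n)
square-not-prime n@(suc (suc m)) _ pn² with prime⇒irreducible pn² (m∣m*n n)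
... | inj₁ ()
... | inj₂ n≡n² with +-cancelˡ-≡ n 0 (suc m * n) (trans (+-identityʳ n) n≡n²)
...   | ()

large-multiple : ∀ {p k} → p ∣ k → 0 < k → k ≢ p → 2 * p ≤ k
large-multiple (divides zero refl) ()
large-multiple {p} (divides (suc zero) refl) _ k≢p = ⊥-elim (k≢p (+-identityʳ p))
large-multiple {p} (divides (suc (suc q)) refl) _ _ = +-monoʳ-≤ p (+-monoʳ-≤ p z≤n)

even-or-odd : ∀ n → 2 ∣ n ⊎ 2 ∣ suc n
even-or-odd zero = inj₁ (divides 0 refl)
even-or-odd (suc n) with even-or-odd n
... | inj₁ 2∣n = inj₂ (subst (2 ∣_) (+-comm n 2) (∣m∣n⇒∣m+n 2∣n ∣-refl))
... | inj₂ 2∣1+n = inj₁ 2∣1+n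

odd-prime-≥3 : ∀ {a} → Prime a → ¬ (2 ∣ a) → 3 ≤ a
odd-prime-≥3 {0} pa _ = ⊥-elim (¬prime[0] pa)
odd-prime-≥3 {1} pa _ = ⊥-elim (¬prime[1] pa)
odd-prime-≥3 {2} _ odd = ⊥-elim (odd ∣-refl)
odd-prime-≥3 {suc (suc (suc _))} _ _ = s≤s (s≤s (s≤s z≤n))

-- The value 2a² + a + 1 at which the lower and the upper bound on c meet.
bound : ℕ → ℕ
bound a = 2 * (a * a) + suc a

-- For odd a both a + 1 and 2a² are even.
bound-even : ∀ {a} → ¬ (2 ∣ a) → 2 ∣ bound a
bound-even {a} odd with even-or-odd a
... | inj₁ 2∣a = ⊥-elim (odd 2∣a)
... | inj₂ 2∣1+a = ∣m∣n⇒∣m+n (m∣m*n (a * a)) 2∣1+a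

-- 2p = (2a² + a + 1) + (a + 1): turns c + a + 1 ≥ 2p into c ≥ bound a.
twice-f : ∀ a → 2 * f a ≡ bound a + suc a
twice-f = expanded
  where
  expanded : ∀ a → 2 * (a * a + a + 1) ≡ 2 * (a * a) + suc a + suc a
  expanded = solve-∀

-- f (2a² + a + 1) = 3p² + a(a - 3)p, written with a = 3 + t.
f-at-bound : ∀ t → f (bound (3 + t)) ≡ 3 * (f (3 + t) * f (3 + t)) + (3 + t) * t * f (3 + t)
f-at-bound = expanded
  where
  expanded : ∀ t → let a = 3 + t ; m = 2 * (a * a) + suc a in
             m * m + m + 1 ≡ 3 * ((a * a + a + 1) * (a * a + a + 1)) + a * t * (a * a + a + 1)
  expanded = solve-∀

above : ∀ {a c} → a < c → ∃[ k ] c ≡ a + suc k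
above {a} a<c with m≤n⇒∃[o]m+o≡n a<c
... | d , refl = d , sym (+-suc a d)

-- Lower bound: if p = f a and c > a are prime, a ≥ 2 and p ∣ f c, then
-- c ≥ 2a² + a + 1.  The prime p divides (c - a)(c + a + 1); neither
-- factor is p (c would be a square), so c + a + 1 ≥ 2p.
lower-bound : ∀ {a c} → 2 ≤ a → Prime (f a) → Prime c → a < c → f a ∣ f c → bound a ≤ c
lower-bound {a} 2≤a pfa pc a<c p∣fc with above a<c
... | k , refl = +-cancelʳ-≤ (suc a) (bound a) c (subst (_≤ s) (twice-f a) 2p≤s)
  where
  p = f a
  c = a + suc k
  s = c + suc a

  p∣product : p ∣ suc k * s
  p∣product = ∣m+n∣m⇒∣n (subst (p ∣_) (f-difference a (suc k)) p∣fc) ∣-refl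

  1+k≤s : suc k ≤ s
  1+k≤s = ≤-trans (m≤n+m (suc k) a) (m≤m+n c (suc a))

  1+k≢p : suc k ≢ p
  1+k≢p 1+k≡p = square-not-prime (suc a) (m≤n⇒m≤1+n 2≤a)
    (subst Prime (trans (cong (a +_) 1+k≡p) (a+f[a]≡square a)) pc)

  s≢p : s ≢ p
  s≢p s≡p = square-not-prime a 2≤a
    (subst Prime (+-cancelʳ-≡ (suc a) c (a * a) (trans s≡p (f[a]≡square+suc a))) pc)

  2p≤s : 2 * p ≤ s
  2p≤s with euclidsLemma (suc k) s pfa p∣product
  ... | inj₁ p∣1+k = ≤-trans (large-multiple p∣1+k z<s 1+k≢p) 1+k≤s
  ... | inj₂ p∣s = large-multiple p∣s (<-≤-trans z<s 1+k≤s) s≢p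

upper-bound : ∀ {a c} → 3 ≤ a → f c ≤ 3 * (f a * f a) → c ≤ bound a
upper-bound 3≤a fc≤3p² with m≤n⇒∃[o]m+o≡n 3≤a
... | t , refl = f-reflects-≤ (≤-trans fc≤3p² 3p²≤f[bound])
  where
  p = f (3 + t)
  3p²≤f[bound] : 3 * (p * p) ≤ f (bound (3 + t))
  3p²≤f[bound] = subst (3 * (p * p) ≤_) (sym (f-at-bound t)) (m≤m+n (3 * (p * p)) ((3 + t) * t * p))

-- The theorem under the symmetry assumption b ≤ a.
no-solution : ∀ {a b c} → b ≤ a → Prime a → ¬ (2 ∣ a) → Prime c → ¬ (2 ∣ c) →
              Prime (f a) → f c ≡ 3 * (f a * f b) → ⊥
no-solution {a} {b} {c} b≤a pa odd-a pc odd-c pfa fc≡3pq =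
  odd-c (subst (2 ∣_) bound≡c (bound-even odd-a))
  where
  p = f a
  q = f b
  instance
    q≢0 = >-nonZero (f-positive b)

  3≤a : 3 ≤ a
  3≤a = odd-prime-≥3 pa odd-a

  pq>0 : 0 < p * q
  pq>0 = <-≤-trans (f-positive a) (m≤m*n p q)

  -- p ≤ pq < pq + 2pq = f c, hence c > a.
  p<fc : p < f c
  p<fc = subst (p <_) (sym fc≡3pq) (≤-<-trans (m≤m*n p q) (m<m+n (p * q) (<-≤-trans pq>0 (m≤m+n _ _))))

  p∣fc : p ∣ f c
  p∣fc = subst (p ∣_) (sym fc≡3pq) (∣n⇒∣m*n 3 (m∣m*n q))

  fc≤3p² : f c ≤ 3 * (p * p)
  fc≤3p² = subst (_≤ 3 * (p * p)) (sym fc≡3pq) (*-monoʳ-≤ 3 (*-monoʳ-≤ p (f-mono-≤ b≤a)))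

  bound≡c : bound a ≡ c
  bound≡c = ≤-antisym (lower-bound (≤-trans (n≤1+n 2) 3≤a) pfa pc (f-reflects-< p<fc) p∣fc)
                      (upper-bound 3≤a fc≤3p²)

lemma34 : ¬ (∃[ a ] ∃[ b ] ∃[ c ] (Prime a × ¬ (2 ∣ a) × Prime b × ¬ (2 ∣ b) × Prime c × ¬ (2 ∣ c) × Prime (f a) × Prime (f b) × f c ≡ 3 * (f a * f b)))
lemma34 (a , b , c , pa , odd-a , pb , odd-b , pc , odd-c , pfa , pfb , fc≡3pq) with ≤-total b a
... | inj₁ b≤a = no-solution b≤a pa odd-a pc odd-c pfa fc≡3pq
... | inj₂ a≤b = no-solution a≤b pb odd-b pc odd-c pfb (trans fc≡3pq (cong (3 *_) (*-comm (f a) (f b))))
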